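{- Let $(\mathbf{C},\mathcal{M})$ be an $\mathcal{M}$-adhesive category satisfying the horizontal VK property and having effective pushouts. Let $t:TG_B\to TG_A$ be a morphism in $\mathcal{M}$. Let $ac_{P_A}$ be a positive nested condition over $P_A$ typed over $TG_A$, and let $p_A:P_A\to G_A$ be a match typed over $TG_A$. Let $ac_{P_B}=\mathrm{Restr}_t(ac_{P_A})$ and $p_B=\mathrm{Restr}_t(p_A):P_B\to G_B$ be their restrictions along $t$. Then for every solution $Q_A$ of $p_A\vDash ac_{P_A}$, its restriction $Q_B=\mathrm{Restr}_t(Q_A)$ is a solution for $p_B\vDash ac_{P_B}$.
   Context: An $\mathcal{M}$-adhesive category $(\mathbf{C},\mathcal{M})$ consists of a category $\mathbf{C}$ and a class $\mathcal{M}$ of monomorphisms closed under isomorphisms, composition and decomposition, such that $\mathbf{C}$ has pushouts and pullbacks along $\mathcal{M}$-morphisms, $\mathcal{M}$ is stable under pushouts and pullbacks, and pushouts along $\mathcal{M}$-morphisms are van Kampen squares in the vertical sense: for every commutative cube with such a pushout as bottom face, all vertical morphisms in $\mathcal{M}$ and pullbacks as back faces, the top face is a pushout iff the front faces are pullbacks. The horizontal VK property is the same VK condition required for commutative cubes whose horizontal morphisms are all in $\mathcal{M}$. Effective pushouts: for $a:B\to X$, $b:C\to X$ in $\mathcal{M}$ with pullback $B\xleftarrow{p_1}A\xrightarrow{p_2}C$, the morphism $D\to X$ induced by the pushout $D$ of $p_1,p_2$ lies in $\mathcal{M}$. An object typed over $TG$ is a morphism $g:G\to TG$. Restriction along $t:TG_B\to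 TG_A\in\mathcal{M}$: for $g_A:G_A\to TG_A$, its restriction is $g_B:G_B\to TG_B$ with $t_G:G_B\to G_A$ such that the square $g_A\circ t_G=t\circ g_B$ is a pullback. For a morphism $a:G'_A\to G_A$ between objects typed over $TG_A$ (typing compatible with $a$), its restriction $\mathrm{Restr}_t(a)=b:G'_B\to G_B$ is given by the pullback square $a\circ t_{G'}=t_G\circ b$, where $t_G:G_B\to G_A$ comes from the restriction of $G_A$. Positive nested conditions over an object $P$: $true$; $\exists(a,ac_C)$ for a morphism $a:P\to C$ and a positive nested condition $ac_C$ over $C$; $\bigwedge_{i\in\mathcal I}ac_{P,i}$ and $\bigvee_{i\in\mathcal I}ac_{P,i}$ for positive nested conditions $ac_{P,i}$ over $P$ with $\mathcal I\neq\emptyset$. The condition is typed over $TG$ if all objects and morphisms occurring at every nesting level are typed over $TG$ compatibly. Its restriction along $t$ is defined recursively: $\mathrm{Restr}_t(true)=true$, $\mathrm{Restr}_t(\exists(a,ac_C))=\exists(\mathrm{Restr}_t(a),\mathrm{Restr}_t(ac_C))$, and restriction commutes with $\bigwedge,\bigvee$. A solution $Q$ for $p\vDash ac_P$ (with $p:P\to G$) is defined inductively: if $ac_P=true$ then $Q=\emptyset$; if $ac_P=\exists(a,ac_C)$ with $a:P\to C$ then $Q=(q,Q_C)$ with $q:C\to G\in\mathcal{M}$, $q\circ a=p$, and $Q_C$ a solution for $q\vDash ac_C$; if $ac_P=\bigwedge_{i}ac_{P,i}$ then $Q=(Q_i)_{i\in\mathcal I}$ with each $Q_i$ a solution for $p\vDash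 ac_{P,i}$; if $ac_P=\bigvee_i ac_{P,i}$ then $Q=(Q_i)_{i\in\mathcal I}$ where for some $j$, $Q_j$ is a solution for $p\vDash ac_{P,j}$ and $Q_k=\emptyset$ for $k\neq j$. (Matches and solutions are required to be compatible with the typing.) The restriction $\mathrm{Restr}_t(Q)$ of a solution is defined componentwise: empty stays empty, $(q,Q_C)\mapsto(\mathrm{Restr}_t(q),\mathrm{Restr}_t(Q_C))$, $(Q_i)_i\mapsto(\mathrm{Restr}_t(Q_i))_i$. -}

module Defs where

open import Level using (Level; _⊔_; suc; zero)
open import Relation.Binary.PropositionalEquality using (_≡_; refl; sym; trans; cong; cong₂)
import Relation.Binary.PropositionalEquality
open import Relation.Nullary using (¬_)
open import Data.Product using (Σ; _×_; _,_; proj₁; proj₂)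

record Category (o ℓ : Level) : Set (suc (o ⊔ ℓ)) where
  infixr 9 _∘_
  field
    Obj  : Set o
    Hom  : Obj → Obj → Set ℓ
    id   : ∀ {A} → Hom A A
    _∘_  : ∀ {A B C} → Hom B C → Hom A B → Hom A C
    identityˡ : ∀ {A B} (f : Hom A B) → id ∘ f ≡ f
    identityʳ : ∀ {A B} (f : Hom A B) → f ∘ id ≡ f
    assoc     : ∀ {A B C D} (h : Hom C D) (g : Hom B C) (f : Hom A B) →
                (h ∘ g) ∘ f ≡ h ∘ (g ∘ f)

module CatDefs {o ℓ : Level} (𝐂 : Category o ℓ) where
  open Category 𝐂

  Mono : ∀ {A B} → Hom A B → Set (o ⊔ ℓ)
  Mono {A} f = ∀ {X} (g h : Hom X A) → f ∘ g ≡ f ∘ h → g ≡ h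

  IsIso : ∀ {A B} → Hom A B → Set ℓ
  IsIso {A} {B} f = Σ (Hom B A) λ g → (g ∘ f ≡ id) × (f ∘ g ≡ id)

  record IsPullback {A B C D : Obj} (f : Hom B D) (g : Hom C D)
                    (p₁ : Hom A B) (p₂ : Hom A C) : Set (o ⊔ ℓ) where
    field
      comm   : f ∘ p₁ ≡ g ∘ p₂
      univ   : ∀ {X} (h₁ : Hom X B) (h₂ : Hom X C) → f ∘ h₁ ≡ g ∘ h₂ → Hom X A
      univ₁  : ∀ {X} {h₁ : Hom X B} {h₂ : Hom X C} (e : f ∘ h₁ ≡ g ∘ h₂) →
               p₁ ∘ univ h₁ h₂ e ≡ h₁
      univ₂  : ∀ {X} {h₁ : Hom X B} {h₂ : Hom X C} (e : f ∘ h₁ ≡ g ∘ h₂) →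
               p₂ ∘ univ h₁ h₂ e ≡ h₂
      unique : ∀ {X} {h₁ : Hom X B} {h₂ : Hom X C} (e : f ∘ h₁ ≡ g ∘ h₂)
               (u : Hom X A) → p₁ ∘ u ≡ h₁ → p₂ ∘ u ≡ h₂ → u ≡ univ h₁ h₂ e

  record IsPushout {A B C D : Obj} (f : Hom A B) (g : Hom A C)
                   (i₁ : Hom B D) (i₂ : Hom C D) : Set (o ⊔ ℓ) where
    field
      comm   : i₁ ∘ f ≡ i₂ ∘ g
      univ   : ∀ {X} (h₁ : Hom B X) (h₂ : Hom C X) → h₁ ∘ f ≡ h₂ ∘ g → Hom D X
      univ₁  : ∀ {X} {h₁ : Hom B X} {h₂ : Hom C X} (e : h₁ ∘ f ≡ h₂ ∘ g) →
               univ h₁ h₂ e ∘ i₁ ≡ h₁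
      univ₂  : ∀ {X} {h₁ : Hom B X} {h₂ : Hom C X} (e : h₁ ∘ f ≡ h₂ ∘ g) →
               univ h₁ h₂ e ∘ i₂ ≡ h₂
      unique : ∀ {X} {h₁ : Hom B X} {h₂ : Hom C X} (e : h₁ ∘ f ≡ h₂ ∘ g)
               (u : Hom D X) → u ∘ i₁ ≡ h₁ → u ∘ i₂ ≡ h₂ → u ≡ univ h₁ h₂ e

  record Pullback {B C D : Obj} (f : Hom B D) (g : Hom C D) : Set (o ⊔ ℓ) where
    field
      apex : Obj
      p₁   : Hom apex B
      p₂   : Hom apex C
      isPullback : IsPullback f g p₁ p₂

  record Pushout {A B C : Obj} (f : Hom A B) (g : Hom A C) : Set (o ⊔ ℓ) where
    field
      apex : Obj
      i₁   : Hom B apex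
      i₂   : Hom C apex
      isPushout : IsPushout f g i₁ i₂

  record Cube : Set (o ⊔ ℓ) where
    field
      A B C D A' B' C' D' : Obj
      m  : Hom A B
      n  : Hom A C
      u  : Hom B D
      v  : Hom C D
      m' : Hom A' B'
      n' : Hom A' C'
      u' : Hom B' D'
      v' : Hom C' D'
      a  : Hom A' A
      b  : Hom B' B
      c  : Hom C' C
      d  : Hom D' D
      bottom-comm : u ∘ m ≡ v ∘ n
      top-comm    : u' ∘ m' ≡ v' ∘ n'
      backL-comm  : b ∘ m' ≡ m ∘ a
      backR-comm  : c ∘ n' ≡ n ∘ a
      frontL-comm : d ∘ u' ≡ u ∘ b
      frontR-comm : d ∘ v' ≡ v ∘ c

    BottomPushout : Set (o ⊔ ℓ)
    BottomPushout = IsPushout m n u v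
    TopPushout : Set (o ⊔ ℓ)
    TopPushout = IsPushout m' n' u' v'
    BackPullbacks : Set (o ⊔ ℓ)
    BackPullbacks = IsPullback b m m' a × IsPullback c n n' a
    FrontPullbacks : Set (o ⊔ ℓ)
    FrontPullbacks = IsPullback d u u' b × IsPullback d v v' c

MorClass : ∀ {o ℓ} → Category o ℓ → (μ : Level) → Set (o ⊔ ℓ ⊔ suc μ)
MorClass 𝐂 μ = ∀ {A B} → Hom A B → Set μ
  where open Category 𝐂

PullbacksAlongM : ∀ {o ℓ μ} (𝐂 : Category o ℓ) → MorClass 𝐂 μ → Set (o ⊔ ℓ ⊔ μ)
PullbacksAlongM 𝐂 M = ∀ {B C D} (f : Hom B D) → M f → (g : Hom C D) → Pullback f g
  where open Category 𝐂
        open CatDefs 𝐂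

record MAdhesive {o ℓ μ} (𝐂 : Category o ℓ) (M : MorClass 𝐂 μ) : Set (o ⊔ ℓ ⊔ μ) where
  open Category 𝐂
  open CatDefs 𝐂
  field
    M-mono    : ∀ {A B} (f : Hom A B) → M f → Mono f
    M-iso     : ∀ {A B} (f : Hom A B) → IsIso f → M f
    M-comp    : ∀ {A B C} (f : Hom A B) (g : Hom B C) → M f → M g → M (g ∘ f)
    M-decomp  : ∀ {A B C} (f : Hom A B) (g : Hom B C) → M (g ∘ f) → M g → M f
    pushoutAlongM  : ∀ {A B C} (f : Hom A B) → M f → (g : Hom A C) → Pushout f g
    pullbackAlongM : PullbacksAlongM 𝐂 M
    M-pushout-stable  : ∀ {A B C D} {f : Hom A B} {g : Hom A C} {i₁ : Hom B D} {i₂ : Hom C D} →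
                        IsPushout f g i₁ i₂ → M f → M i₂
    M-pullback-stable : ∀ {A B C D} {f : Hom B D} {g : Hom C D} {p₁ : Hom A B} {p₂ : Hom A C} →
                        IsPullback f g p₁ p₂ → M f → M p₂
    vertical-VK : (K : Cube) → let open Cube K in
                  M m → BottomPushout →
                  M a → M b → M c → M d →
                  BackPullbacks →
                  (TopPushout → FrontPullbacks) × (FrontPullbacks → TopPushout)

HorizontalVK : ∀ {o ℓ μ} (𝐂 : Category o ℓ) → MorClass 𝐂 μ → Set (o ⊔ ℓ ⊔ μ)
HorizontalVK 𝐂 M =
  (K : Cube) → let open Cube K in
  M m → M n → M u → M v → M m' → M n' → M u' → M v' →
  BottomPushout → BackPullbacks →
  (TopPushout → FrontPullbacks) × (FrontPullbacks → TopPushout)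
  where open CatDefs 𝐂

EffectivePushouts : ∀ {o ℓ μ} (𝐂 : Category o ℓ) → MorClass 𝐂 μ → Set (o ⊔ ℓ ⊔ μ)
EffectivePushouts 𝐂 M =
  ∀ {A B C D X} (a : Hom B X) (b : Hom C X) → M a → M b →
  (p₁ : Hom A B) (p₂ : Hom A C) → IsPullback a b p₁ p₂ →
  (i₁ : Hom B D) (i₂ : Hom C D) → IsPushout p₁ p₂ i₁ i₂ →
  (x : Hom D X) → x ∘ i₁ ≡ a → x ∘ i₂ ≡ b → M x
  where open Category 𝐂
        open CatDefs 𝐂

module Typed {o ℓ μ} (𝐂 : Category o ℓ) (M : MorClass 𝐂 μ) where
  open Category 𝐂

  record TObj (TG : Obj) : Set (o ⊔ ℓ) where
    constructor tobj
    field
      obj : Obj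
      typ : Hom obj TG
  open TObj public

  record THom {TG : Obj} (X Y : TObj TG) : Set ℓ where
    constructor thom
    field
      mor    : Hom (obj X) (obj Y)
      typing : typ Y ∘ mor ≡ typ X
  open THom public

  -- positive nested conditions over P, typed over TG
  -- (index sets are nonempty: a chosen element is part of the data)
  data PosCond {TG : Obj} : TObj TG → Set (suc Level.zero ⊔ o ⊔ ℓ) where
    true : ∀ {P} → PosCond P
    ∃c   : ∀ {P C} → THom P C → PosCond C → PosCond P
    ⋀    : ∀ {P} (I : Set) → I → (I → PosCond P) → PosCond P
    ⋁    : ∀ {P} (I : Set) → I → (I → PosCond P) → PosCond P

  data RawSol {TG : Obj} (G : TObj TG) : Set (suc Level.zero ⊔ o ⊔ ℓ) where
    ∅    : RawSol G
    pair : (C : TObj TG) → THom C G → RawSol G → RawSol G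
    fam  : (I : Set) → (I → RawSol G) → RawSol G

  data IsSolution {TG : Obj} {P G : TObj TG} :
         PosCond P → THom P G → RawSol G → Set (suc Level.zero ⊔ o ⊔ ℓ ⊔ μ) where
    sol-true : ∀ {p} → IsSolution true p ∅
    sol-∃    : ∀ {C} {a : THom P C} {acC : PosCond C} {p : THom P G}
               (q : THom C G) {QC : RawSol G} →
               M (mor q) → mor q ∘ mor a ≡ mor p →
               IsSolution acC q QC →
               IsSolution (∃c a acC) p (pair C q QC)
    sol-⋀    : ∀ {I i₀ acs p} {Qs : I → RawSol G} →
               (∀ i → IsSolution (acs i) p (Qs i)) →
               IsSolution (⋀ I i₀ acs) p (fam I Qs)
    sol-⋁    : ∀ {I i₀ acs p} {Qs : I → RawSol G} (j : I) →
               IsSolution (acs j) p (Qs j) →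
               (∀ k → ¬ (k ≡ j) → Qs k ≡ ∅) →
               IsSolution (⋁ I i₀ acs) p (fam I Qs)

module Restriction {o ℓ μ} (𝐂 : Category o ℓ) (M : MorClass 𝐂 μ)
                   (pb : PullbacksAlongM 𝐂 M)
                   {TGA TGB : Category.Obj 𝐂} (t : Category.Hom 𝐂 TGB TGA) (tM : M t) where
  open Category 𝐂
  open CatDefs 𝐂
  open Typed 𝐂 M
  open Relation.Binary.PropositionalEquality.≡-Reasoning

  private
    module PB (X : TObj TGA) = Pullback (pb t tM (typ X))

  RestrObj : TObj TGA → TObj TGB
  RestrObj X = tobj (PB.apex X) (PB.p₁ X)

  tG : (X : TObj TGA) → Hom (obj (RestrObj X)) (obj X)
  tG X = PB.p₂ X

  RestrMor : ∀ {X Y : TObj TGA} → THom X Y → THom (RestrObj X) (RestrObj Y)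
  RestrMor {X} {Y} f =
    thom (IsPullback.univ (PB.isPullback Y) (PB.p₁ X) (mor f ∘ PB.p₂ X) eq)
         (IsPullback.univ₁ (PB.isPullback Y) eq)
    where
      eq : t ∘ PB.p₁ X ≡ typ Y ∘ (mor f ∘ PB.p₂ X)
      eq = begin
        t ∘ PB.p₁ X                 ≡⟨ IsPullback.comm (PB.isPullback X) ⟩
        typ X ∘ PB.p₂ X             ≡⟨ cong (_∘ PB.p₂ X) (sym (typing f)) ⟩
        (typ Y ∘ mor f) ∘ PB.p₂ X   ≡⟨ assoc _ _ _ ⟩
        typ Y ∘ (mor f ∘ PB.p₂ X)   ∎

  RestrCond : ∀ {P : TObj TGA} → PosCond P → PosCond (RestrObj P)
  RestrCond true        = true
  RestrCond (∃c a acC)  = ∃c (RestrMor a) (RestrCond acC)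
  RestrCond (⋀ I i₀ acs) = ⋀ I i₀ (λ i → RestrCond (acs i))
  RestrCond (⋁ I i₀ acs) = ⋁ I i₀ (λ i → RestrCond (acs i))

  RestrSol : ∀ {G : TObj TGA} → RawSol G → RawSol (RestrObj G)
  RestrSol ∅            = ∅
  RestrSol (pair C q Q) = pair (RestrObj C) (RestrMor q) (RestrSol Q)
  RestrSol (fam I Qs)   = fam I (λ i → RestrSol (Qs i))

module Submission where

open import Defs
open import Relation.Binary.PropositionalEquality

-- Only two facts about
-- the restriction functor are needed for the inductive step (∃(a, ac_C)):
--   (1) restriction preserves M: if q ∈ M then Restr_t(q) ∈ M, because
--       t_C, t_G ∈ M (M is stable under pullback) and t_G ∘ Restr_t(q)
--       = q ∘ t_C, so M-composition and M-decomposition apply;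
--   (2) restriction preserves commuting triangles: q ∘ a = p implies
--       Restr_t(q) ∘ Restr_t(a) = Restr_t(p), because both sides agree
--       after the two projections of the pullback defining G_B, and
--       pullback projections are jointly monic.
-- The ⋀ and ⋁ cases are immediate since restriction acts componentwise
-- and maps ∅ to ∅.

module _ {o ℓ} (𝐂 : Category o ℓ) where
  open Category 𝐂
  open CatDefs 𝐂

  pullback-jointly-monic :
    ∀ {A B C D X} {f : Hom B D} {g : Hom C D} {p₁ : Hom A B} {p₂ : Hom A C} →
    IsPullback f g p₁ p₂ → (u v : Hom X A) →
    p₁ ∘ u ≡ p₁ ∘ v → p₂ ∘ u ≡ p₂ ∘ v → u ≡ v
  pullback-jointly-monic {f = f} {g} {p₁} {p₂} pb u v e₁ e₂ =
    trans (unique cone u e₁ e₂) (sym (unique cone v refl refl))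
    where
      open IsPullback pb
      open ≡-Reasoning
      cone : f ∘ (p₁ ∘ v) ≡ g ∘ (p₂ ∘ v)
      cone = begin
        f ∘ (p₁ ∘ v)   ≡⟨ sym (assoc f p₁ v) ⟩
        (f ∘ p₁) ∘ v   ≡⟨ cong (_∘ v) comm ⟩
        (g ∘ p₂) ∘ v   ≡⟨ assoc g p₂ v ⟩
        g ∘ (p₂ ∘ v)   ∎

module _ {o ℓ μ} {𝐂 : Category o ℓ} {M : MorClass 𝐂 μ} (adh : MAdhesive 𝐂 M) where
  open Category 𝐂
  open MAdhesive adh

  M-square : ∀ {A B C D} {b : Hom A B} {k : Hom B D} {h : Hom A C} {a : Hom C D} →
             k ∘ b ≡ a ∘ h → M h → M a → M k → M b
  M-square {b = b} {k} {h} {a} sq hM aM kM =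
    M-decomp b k (subst M (sym sq) (M-comp h a hM aM)) kM

module RestrictionFacts {o ℓ μ} (𝐂 : Category o ℓ) (M : MorClass 𝐂 μ)
    (adh : MAdhesive 𝐂 M)
    {TGA TGB : Category.Obj 𝐂} (t : Category.Hom 𝐂 TGB TGA) (tM : M t) where
  open Category 𝐂
  open CatDefs 𝐂
  open Typed 𝐂 M
  open MAdhesive adh
  open Restriction 𝐂 M pullbackAlongM t tM
  open ≡-Reasoning

  restr-pullback : (X : TObj TGA) → IsPullback t (typ X) (typ (RestrObj X)) (tG X)
  restr-pullback X = Pullback.isPullback (pullbackAlongM t tM (typ X))

  tG-in-M : (X : TObj TGA) → M (tG X)
  tG-in-M X = M-pullback-stable (restr-pullback X) tM

  restr-square : ∀ {X Y} (f : THom X Y) → tG Y ∘ mor (RestrMor f) ≡ mor f ∘ tG X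
  restr-square {Y = Y} f = IsPullback.univ₂ (restr-pullback Y) _

  restr-preserves-M : ∀ {X Y} (f : THom X Y) → M (mor f) → M (mor (RestrMor f))
  restr-preserves-M {X} {Y} f fM =
    M-square adh (restr-square f) (tG-in-M X) fM (tG-in-M Y)

  restr-preserves-triangle : ∀ {P C G} (a : THom P C) (q : THom C G) (p : THom P G) →
    mor q ∘ mor a ≡ mor p → mor (RestrMor q) ∘ mor (RestrMor a) ≡ mor (RestrMor p)
  restr-preserves-triangle {P} {C} {G} a q p qa≡p =
    pullback-jointly-monic 𝐂 (restr-pullback G) (qB ∘ aB) (mor (RestrMor p)) typing-part tG-part
    where
      qB = mor (RestrMor q)
      aB = mor (RestrMor a)
      -- both sides are typed morphisms into Restr G over Restr P
      typing-part : typ (RestrObj G) ∘ (qB ∘ aB) ≡ typ (RestrObj G) ∘ mor (RestrMor p)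
      typing-part = begin
        typ (RestrObj G) ∘ (qB ∘ aB)   ≡⟨ sym (assoc _ qB aB) ⟩
        (typ (RestrObj G) ∘ qB) ∘ aB   ≡⟨ cong (_∘ aB) (typing (RestrMor q)) ⟩
        typ (RestrObj C) ∘ aB          ≡⟨ typing (RestrMor a) ⟩
        typ (RestrObj P)               ≡⟨ sym (typing (RestrMor p)) ⟩
        typ (RestrObj G) ∘ mor (RestrMor p) ∎
      -- after t_G both sides become q ∘ a ∘ t_P = p ∘ t_P
      tG-part : tG G ∘ (qB ∘ aB) ≡ tG G ∘ mor (RestrMor p)
      tG-part = begin
        tG G ∘ (qB ∘ aB)             ≡⟨ sym (assoc _ qB aB) ⟩
        (tG G ∘ qB) ∘ aB             ≡⟨ cong (_∘ aB) (restr-square q) ⟩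
        (mor q ∘ tG C) ∘ aB          ≡⟨ assoc (mor q) (tG C) aB ⟩
        mor q ∘ (tG C ∘ aB)          ≡⟨ cong (mor q ∘_) (restr-square a) ⟩
        mor q ∘ (mor a ∘ tG P)       ≡⟨ sym (assoc (mor q) (mor a) (tG P)) ⟩
        (mor q ∘ mor a) ∘ tG P       ≡⟨ cong (_∘ tG P) qa≡p ⟩
        mor p ∘ tG P                 ≡⟨ sym (restr-square p) ⟩
        tG G ∘ mor (RestrMor p)      ∎

  restrict-solution : ∀ {PA GA : TObj TGA} (acA : PosCond PA) (pA : THom PA GA)
    (QA : RawSol GA) → IsSolution acA pA QA →
    IsSolution (RestrCond acA) (RestrMor pA) (RestrSol QA)
  restrict-solution true pA ∅ sol-true = sol-true
  restrict-solution (∃c a acC) pA (pair C q QC) (sol-∃ .q qM qa≡p solC) =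
    sol-∃ (RestrMor q) (restr-preserves-M q qM) (restr-preserves-triangle a q pA qa≡p)
          (restrict-solution acC q QC solC)
  restrict-solution (⋀ I i₀ acs) pA (fam .I Qs) (sol-⋀ sols) =
    sol-⋀ (λ i → restrict-solution (acs i) pA (Qs i) (sols i))
  restrict-solution (⋁ I i₀ acs) pA (fam .I Qs) (sol-⋁ j solj others-empty) =
    sol-⋁ j (restrict-solution (acs j) pA (Qs j) solj)
            (λ k k≢j → cong RestrSol (others-empty k k≢j))

fact3p4 : ∀ {o ℓ μ} (𝐂 : Category o ℓ) (M : MorClass 𝐂 μ)
    (adh : MAdhesive 𝐂 M) → HorizontalVK 𝐂 M → EffectivePushouts 𝐂 M →
    ∀ {TGA TGB : Category.Obj 𝐂} (t : Category.Hom 𝐂 TGB TGA) (tM : M t) →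
    ∀ {PA GA : Typed.TObj 𝐂 M TGA}
    (acA : Typed.PosCond 𝐂 M PA) (pA : Typed.THom 𝐂 M PA GA)
    (QA : Typed.RawSol 𝐂 M GA) →
    Typed.IsSolution 𝐂 M acA pA QA →
    Typed.IsSolution 𝐂 M
    (Restriction.RestrCond 𝐂 M (MAdhesive.pullbackAlongM adh) t tM acA)
    (Restriction.RestrMor 𝐂 M (MAdhesive.pullbackAlongM adh) t tM pA)
    (Restriction.RestrSol 𝐂 M (MAdhesive.pullbackAlongM adh) t tM QA)
fact3p4 𝐂 M adh _ _ t tM = RestrictionFacts.restrict-solution 𝐂 M adh t tM
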